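{- Let $(\mathcal{X},d)$ be a standard $\mathcal{R}$-metric space. Then $\mathrm{IE}(\mathcal{X})$ with the metric pointwise topology $\tau_{mpw}$ is a Hausdorff topological semigroup.
   Context: A distance monoid $\mathcal{R}=(R,\le,\oplus,0)$ is a commutative monoid with total order such that $r\le r\oplus s$ and $s\le s'\Rightarrow s\oplus t\le s'\oplus t$; standard means: whenever $0\ne r$ and $s<r$ there is $0\ne t$ with $s\oplus t<r$. An $\mathcal{R}$-metric space has $d:X^2\to R$ with $d(x,y)=0\iff x=y$, symmetry and the triangle inequality $d(x,z)\le d(x,y)\oplus d(y,z)$; standard if $\mathcal{R}$ is. $\mathrm{IE}(\mathcal{X})$ is the monoid of isometric self-embeddings. $\tau_{mpw}$ is the restriction to $\mathrm{IE}(\mathcal{X})$ of the product topology on $X^X$, where $X$ has the topology with basis the balls $B_\epsilon(a)=\{b:d(a,b)<\epsilon\}$, $\epsilon\in R\setminus\{0\}$. -}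

module Defs where

open import Level using (Level; suc; _⊔_)
open import Data.Product using (Σ; ∃; ∃₂; _×_; _,_; proj₁; proj₂)
open import Data.List using (List)
open import Data.List.Relation.Unary.All using (All)
open import Relation.Unary using (Pred)
open import Relation.Binary.PropositionalEquality using (_≡_; refl; trans; sym)
open import Relation.Binary.Structures using (IsTotalOrder)
open import Algebra.Structures using (IsCommutativeMonoid)
open import Relation.Nullary using (¬_)
open import Data.Empty using (⊥)

record DistanceMonoid (ℓ : Level) : Set (suc ℓ) where
  infixl 6 _⊕_
  infix 4 _≤_ _<_
  field
    R                   : Set ℓ
    _≤_                 : R → R → Set ℓ
    _⊕_                 : R → R → R
    𝟘                   : R
    isCommutativeMonoid : IsCommutativeMonoid _≡_ _⊕_ 𝟘
    isTotalOrder        : IsTotalOrder _≡_ _≤_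
    ≤-⊕                 : ∀ r s → r ≤ r ⊕ s
    ⊕-mono              : ∀ {s s'} t → s ≤ s' → s ⊕ t ≤ s' ⊕ t

  _<_ : R → R → Set ℓ
  s < r = (s ≤ r) × ¬ (s ≡ r)

IsStandard : ∀ {ℓ} → DistanceMonoid ℓ → Set ℓ
IsStandard D = ∀ r s → ¬ (r ≡ 𝟘) → s < r → ∃ λ t → ¬ (t ≡ 𝟘) × (s ⊕ t < r)
  where open DistanceMonoid D

record MetricSpace {ℓ} (D : DistanceMonoid ℓ) : Set (suc ℓ) where
  open DistanceMonoid D
  field
    X        : Set ℓ
    d        : X → X → R
    d≡0→≡    : ∀ x y → d x y ≡ 𝟘 → x ≡ y
    ≡→d≡0    : ∀ x y → x ≡ y → d x y ≡ 𝟘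
    d-sym    : ∀ x y → d x y ≡ d y x
    triangle : ∀ x y z → d x z ≤ d x y ⊕ d y z

module _ {ℓ} {D : DistanceMonoid ℓ} (M : MetricSpace D) where
  open DistanceMonoid D
  open MetricSpace M

  Ball : R → X → Pred X ℓ
  Ball ε a b = d a b < ε

  IsOpenX : Pred X ℓ → Set ℓ
  IsOpenX U = ∀ b → U b →
    ∃₂ λ ε a → ¬ (ε ≡ 𝟘) × Ball ε a b × (∀ c → Ball ε a c → U c)

  -- open sets of X^X in the product topology: around each point there is a
  -- basic open set  { g : g(x_i) ∈ U_i, i = 1..n }  with U_i open in X
  IsOpenXX : Pred (X → X) ℓ → Set (suc ℓ)
  IsOpenXX W = ∀ h → W h →
    Σ (List (X × Pred X ℓ)) λ F →
        All (λ p → IsOpenX (proj₂ p)) F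
      × All (λ p → proj₂ p (h (proj₁ p))) F
      × (∀ g → All (λ p → proj₂ p (g (proj₁ p))) F → W g)

  record IE : Set ℓ where
    constructor mkIE
    field
      fun : X → X
      iso : ∀ x y → d (fun x) (fun y) ≡ d x y
  open IE public

  _∘IE_ : IE → IE → IE
  f ∘IE g = mkIE (λ x → fun f (fun g x))
                 (λ x y → trans (iso f (fun g x) (fun g y)) (iso g x y))

  _≈IE_ : IE → IE → Set ℓ
  f ≈IE g = ∀ x → fun f x ≡ fun g x

  -- τ_mpw: subspace topology on IE(X) induced by the product topology on X^X
  IsOpenMPW : Pred IE ℓ → Set (suc ℓ)
  IsOpenMPW V = ∃ λ (W : Pred (X → X) ℓ) →
    IsOpenXX W × (∀ f → (V f → W (fun f)) × (W (fun f) → V f))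

  IsHausdorffMPW : Set (suc ℓ)
  IsHausdorffMPW = ∀ f g → ¬ (f ≈IE g) →
    ∃₂ λ (U V : Pred IE ℓ) → IsOpenMPW U × IsOpenMPW V × U f × V g
      × (∀ h → U h → V h → ⊥)

  IsOpenMPW² : Pred (IE × IE) ℓ → Set (suc ℓ)
  IsOpenMPW² P = ∀ f g → P (f , g) →
    ∃₂ λ (U V : Pred IE ℓ) → IsOpenMPW U × IsOpenMPW V × U f × V g
      × (∀ f' g' → U f' → V g' → P (f' , g'))

  ∘IE-Continuous : Set (suc ℓ)
  ∘IE-Continuous = ∀ (W : Pred IE ℓ) → IsOpenMPW W →
    IsOpenMPW² (λ p → W (proj₁ p ∘IE proj₂ p))

  IsHausdorffTopSemigroup : Set (suc ℓ)
  IsHausdorffTopSemigroup =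
      (∀ f g h → (f ∘IE (g ∘IE h)) ≈IE ((f ∘IE g) ∘IE h))
    × ∘IE-Continuous
    × IsHausdorffMPW

{-# OPTIONS --safe #-}
-- Composition is continuous because isometries do not stretch distances:
-- if f' moves f(g x) by less than t and g' moves g x by less than t', then
-- f'(g' x) lies within d(a, f(g x)) ⊕ t ⊕ t' of any a, and standardness
-- provides positive t, t' keeping this below a prescribed radius.  For the
-- Hausdorff property, f x ≠ g x for some x (this is where excluded middle
-- enters), and balls of radii t, t' with t ⊕ t' < d(f x, g x) around f x and
-- g x are disjoint by the triangle inequality.
module Submission where

open import Defs
open import Axiom.ExcludedMiddle using (ExcludedMiddle)
open import Axiom.DoubleNegationElimination using (DoubleNegationElimination; em⇒dne)
open import Level using (_⊔_)
open import Data.Product using (∃; ∃₂; _×_; _,_; proj₁; proj₂)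
open import Data.List using (List; []; _∷_; _++_)
open import Data.List.Relation.Unary.All as All using (All; []; _∷_)
open import Data.List.Relation.Unary.All.Properties using (++⁺; ++⁻ˡ; ++⁻ʳ)
open import Data.Unit.Polymorphic using (⊤; tt)
open import Data.Empty using (⊥)
open import Function using (id)
open import Relation.Unary using (Pred; _∩_)
open import Relation.Nullary using (¬_)
open import Relation.Binary.PropositionalEquality using (_≡_; refl; subst; sym)
open import Relation.Binary.Structures using (IsTotalOrder)
open import Algebra.Structures using (IsCommutativeMonoid)

¬∀⇒∃¬ : ∀ {a} {A : Set a} {P : Pred A a} → DoubleNegationElimination a →
  ¬ (∀ x → P x) → ∃ λ x → ¬ P x
¬∀⇒∃¬ dne ¬∀ = dne λ ¬∃¬ → ¬∀ λ x → dne λ ¬Px → ¬∃¬ (x , ¬Px)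

module DistanceMonoidProperties {ℓ} (D : DistanceMonoid ℓ) where
  open DistanceMonoid D
  open IsTotalOrder isTotalOrder public
    using () renaming (trans to ≤-trans; antisym to ≤-antisym)
  open IsCommutativeMonoid isCommutativeMonoid
    using () renaming (comm to ⊕-comm; identityˡ to ⊕-identityˡ)

  ≤-<-trans : ∀ {a b c} → a ≤ b → b < c → a < c
  ≤-<-trans a≤b (b≤c , b≢c) =
    ≤-trans a≤b b≤c , λ { refl → b≢c (≤-antisym b≤c a≤b) }

  <-irrefl : ∀ {r} → ¬ (r < r)
  <-irrefl (_ , r≢r) = r≢r refl

  ⊕-monoʳ-≤ : ∀ {s s'} t → s ≤ s' → t ⊕ s ≤ t ⊕ s'
  ⊕-monoʳ-≤ {s} {s'} t s≤s' =
    subst (_≤ t ⊕ s') (⊕-comm s t) (subst (s ⊕ t ≤_) (⊕-comm s' t) (⊕-mono t s≤s'))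

  ⊕-mono-≤ : ∀ {r r' s s'} → r ≤ r' → s ≤ s' → r ⊕ s ≤ r' ⊕ s'
  ⊕-mono-≤ {s = s} r≤r' s≤s' = ≤-trans (⊕-mono s r≤r') (⊕-monoʳ-≤ _ s≤s')

  𝟘-minimum : ∀ r → 𝟘 ≤ r
  𝟘-minimum r = subst (𝟘 ≤_) (⊕-identityˡ r) (≤-⊕ 𝟘 r)

  ≢𝟘⇒𝟘< : ∀ {r} → ¬ (r ≡ 𝟘) → 𝟘 < r
  ≢𝟘⇒𝟘< r≢𝟘 = 𝟘-minimum _ , λ 𝟘≡r → r≢𝟘 (sym 𝟘≡r)

  <⇒≢𝟘 : ∀ {s r} → s < r → ¬ (r ≡ 𝟘)
  <⇒≢𝟘 (s≤r , s≢r) refl = s≢r (≤-antisym s≤r (𝟘-minimum _))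

  split-gap : IsStandard D → ∀ {s r} → s < r →
    ∃₂ λ t t' → ¬ (t ≡ 𝟘) × ¬ (t' ≡ 𝟘) × s ⊕ t ⊕ t' < r
  split-gap std s<r with std _ _ (<⇒≢𝟘 s<r) s<r
  ... | t , t≢𝟘 , s⊕t<r with std _ _ (<⇒≢𝟘 s<r) s⊕t<r
  ... | t' , t'≢𝟘 , s⊕t⊕t'<r = t , t' , t≢𝟘 , t'≢𝟘 , s⊕t⊕t'<r

  split-positive : IsStandard D → ∀ {r} → ¬ (r ≡ 𝟘) →
    ∃₂ λ t t' → ¬ (t ≡ 𝟘) × ¬ (t' ≡ 𝟘) × t ⊕ t' < r
  split-positive std r≢𝟘 with split-gap std (≢𝟘⇒𝟘< r≢𝟘)
  ... | t , t' , t≢𝟘 , t'≢𝟘 , 𝟘⊕t⊕t'<r =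
    t , t' , t≢𝟘 , t'≢𝟘 , subst (λ u → u ⊕ t' < _) (⊕-identityˡ t) 𝟘⊕t⊕t'<r

module MetricSpaceProperties {ℓ} {D : DistanceMonoid ℓ} (M : MetricSpace D) where
  open DistanceMonoid D
  open MetricSpace M
  open DistanceMonoidProperties D

  centre∈Ball : ∀ {t} a → ¬ (t ≡ 𝟘) → Ball M t a a
  centre∈Ball a t≢𝟘 = subst (_< _) (sym (≡→d≡0 a a refl)) (≢𝟘⇒𝟘< t≢𝟘)

  Ball-open : ∀ t a → IsOpenX M (Ball M t a)
  Ball-open t a b b∈Ball = t , a , <⇒≢𝟘 b∈Ball , b∈Ball , λ _ c∈Ball → c∈Ball

  triangle₃ : ∀ a b c e → d a e ≤ d a b ⊕ d b c ⊕ d c e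
  triangle₃ a b c e = ≤-trans (triangle a c e) (⊕-mono _ (triangle a b c))

  Balls-disjoint : ∀ {t t' a b c} → t ⊕ t' < d a b →
    Ball M t a c → Ball M t' b c → ⊥
  Balls-disjoint {a = a} {b} {c} t⊕t'<dab (dac≤t , _) (dbc≤t' , _) =
    <-irrefl (≤-<-trans dab≤t⊕t' t⊕t'<dab)
    where
      dab≤t⊕t' : d a b ≤ _
      dab≤t⊕t' = ≤-trans (triangle a c b)
        (⊕-mono-≤ dac≤t (subst (_≤ _) (d-sym b c) dbc≤t'))

module MetricPointwiseTopology {ℓ} {D : DistanceMonoid ℓ} (M : MetricSpace D) where
  open MetricSpace M
  open MetricSpaceProperties M

  ⊤-open : IsOpenMPW M (λ _ → ⊤)
  ⊤-open = (λ _ → ⊤) , (λ _ _ → [] , [] , [] , λ _ _ → tt) , λ _ → id , id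

  ∩-open : ∀ {U V} → IsOpenMPW M U → IsOpenMPW M V → IsOpenMPW M (U ∩ V)
  ∩-open (W₁ , W₁-open , U↔W₁) (W₂ , W₂-open , V↔W₂) =
    W₁ ∩ W₂ , W∩-open , λ f →
      (λ (u , v) → proj₁ (U↔W₁ f) u , proj₁ (V↔W₂ f) v) ,
      (λ (w₁ , w₂) → proj₂ (U↔W₁ f) w₁ , proj₂ (V↔W₂ f) w₂)
    where
      W∩-open : IsOpenXX M (W₁ ∩ W₂)
      W∩-open h (w₁ , w₂) with W₁-open h w₁ | W₂-open h w₂
      ... | F₁ , open₁ , h∈₁ , ⊆W₁ | F₂ , open₂ , h∈₂ , ⊆W₂ =
        F₁ ++ F₂ , ++⁺ open₁ open₂ , ++⁺ h∈₁ h∈₂ ,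
        λ g g∈ → ⊆W₁ g (++⁻ˡ F₁ g∈) , ⊆W₂ g (++⁻ʳ F₁ g∈)

  eval⁻¹-Ball-open : ∀ x t a → IsOpenMPW M (λ h → Ball M t a (fun h x))
  eval⁻¹-Ball-open x t a =
    (λ k → Ball M t a (k x)) ,
    (λ _ h∈ → (x , Ball M t a) ∷ [] , Ball-open t a ∷ [] , h∈ ∷ [] ,
              λ { _ (g∈ ∷ []) → g∈ }) ,
    λ _ → id , id

  OpenRectangleIn : ∀ {k} → IE M → IE M → Pred (IE M × IE M) k → Set (Level.suc ℓ ⊔ k)
  OpenRectangleIn f g Q = ∃₂ λ (U V : Pred (IE M) ℓ) →
    IsOpenMPW M U × IsOpenMPW M V × U f × V g × (∀ f' g' → U f' → V g' → Q (f' , g'))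

  module _ {f g : IE M} where

    rectangle-∩ : ∀ {k k'} {Q : Pred _ k} {Q' : Pred _ k'} →
      OpenRectangleIn f g Q → OpenRectangleIn f g Q' → OpenRectangleIn f g (Q ∩ Q')
    rectangle-∩ (U , V , U-open , V-open , f∈U , g∈V , U×V⊆Q)
                (U' , V' , U'-open , V'-open , f∈U' , g∈V' , U'×V'⊆Q') =
      U ∩ U' , V ∩ V' , ∩-open U-open U'-open , ∩-open V-open V'-open ,
      (f∈U , f∈U') , (g∈V , g∈V') ,
      λ f' g' (u , u') (v , v') → U×V⊆Q f' g' u v , U'×V'⊆Q' f' g' u' v'

    rectangle-All : ∀ {a k} {A : Set a} {Q : A → Pred _ k} (F : List A) →
      All (λ p → OpenRectangleIn f g (Q p)) F →
      OpenRectangleIn f g (λ q → All (λ p → Q p q) F)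
    rectangle-All [] [] = _ , _ , ⊤-open , ⊤-open , tt , tt , λ _ _ _ _ → []
    rectangle-All (_ ∷ F) (R ∷ Rs)
      with U , V , U-open , V-open , f∈U , g∈V , U×V⊆Q ← rectangle-∩ R (rectangle-All F Rs) =
      U , V , U-open , V-open , f∈U , g∈V ,
      λ f' g' u v → let (q , qs) = U×V⊆Q f' g' u v in q ∷ qs

module Composition {ℓ} {D : DistanceMonoid ℓ} (M : MetricSpace D) where
  open DistanceMonoid D
  open MetricSpace M
  open DistanceMonoidProperties D
  open MetricSpaceProperties M
  open MetricPointwiseTopology M

  ∘IE-assoc : ∀ f g h → _≈IE_ M (_∘IE_ M f (_∘IE_ M g h)) (_∘IE_ M (_∘IE_ M f g) h)
  ∘IE-assoc _ _ _ _ = refl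

  ∘IE-continuous-eval : IsStandard D → ∀ {f g} x {U} → IsOpenX M U →
    U (fun f (fun g x)) → OpenRectangleIn f g (λ (f' , g') → U (fun f' (fun g' x)))
  ∘IE-continuous-eval std {f} {g} x U-open fgx∈U
    with ε , a , _ , fgx∈Ball , Ball⊆U ← U-open _ fgx∈U
    with t , t' , t≢𝟘 , t'≢𝟘 , margin ← split-gap std fgx∈Ball =
    (λ h → Ball M t fgx (fun h gx)) , (λ h → Ball M t' gx (fun h x)) ,
    eval⁻¹-Ball-open gx t fgx , eval⁻¹-Ball-open x t' gx ,
    centre∈Ball fgx t≢𝟘 , centre∈Ball gx t'≢𝟘 ,
    λ f' g' u v → Ball⊆U _ (≤-<-trans (bound f' g' u v) margin)
    where
      gx = fun g x
      fgx = fun f gx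
      bound : ∀ f' g' → Ball M t fgx (fun f' gx) → Ball M t' gx (fun g' x) →
        d a (fun f' (fun g' x)) ≤ d a fgx ⊕ t ⊕ t'
      bound f' g' (d≤t , _) (d≤t' , _) =
        ≤-trans (triangle₃ a fgx (fun f' gx) (fun f' (fun g' x)))
          (⊕-mono-≤ (⊕-monoʳ-≤ (d a fgx) d≤t)
            (subst (_≤ t') (sym (iso f' gx (fun g' x))) d≤t'))

  ∘IE-continuous : IsStandard D → ∘IE-Continuous M
  ∘IE-continuous std W (W' , W'-open , W↔W') f g fg∈W
    with F , Fs-open , fg∈F , F⊆W' ← W'-open _ (proj₁ (W↔W' (_∘IE_ M f g)) fg∈W)
    with U , V , U-open , V-open , f∈U , g∈V , U×V⊆F ←
      rectangle-All F (All.zipWith (λ (U-open , fgx∈U) →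
                                      ∘IE-continuous-eval std _ U-open fgx∈U)
                                   (Fs-open , fg∈F)) =
    U , V , U-open , V-open , f∈U , g∈V ,
    λ f' g' u v → proj₂ (W↔W' (_∘IE_ M f' g')) (F⊆W' _ (U×V⊆F f' g' u v))

  IE-hausdorff : ExcludedMiddle ℓ → IsStandard D → IsHausdorffMPW M
  IE-hausdorff em std f g f≉g
    with x , fx≢gx ← ¬∀⇒∃¬ (em⇒dne em) f≉g
    with t , t' , t≢𝟘 , t'≢𝟘 , t⊕t'<d ← split-positive std (λ d≡𝟘 → fx≢gx (d≡0→≡ _ _ d≡𝟘)) =
    (λ h → Ball M t fx (fun h x)) , (λ h → Ball M t' gx (fun h x)) ,
    eval⁻¹-Ball-open x t fx , eval⁻¹-Ball-open x t' gx ,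
    centre∈Ball fx t≢𝟘 , centre∈Ball gx t'≢𝟘 ,
    λ _ → Balls-disjoint t⊕t'<d
    where
      fx = fun f x
      gx = fun g x

lemma7p13 : ∀ {ℓ} → ExcludedMiddle ℓ → (D : DistanceMonoid ℓ) → IsStandard D →
    (M : MetricSpace D) → IsHausdorffTopSemigroup M
lemma7p13 em D std M =
  ∘IE-assoc , ∘IE-continuous std , IE-hausdorff em std
  where open Composition M
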